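{- For every projective plane $\Pi_q$ of order $q$ and positive integer $r$, $m_r(\Pi_q)\le (r-1)r+1$.
   Context: A finite projective plane $\Pi_q$ of order $q\ge 2$ has $q^2+q+1$ points and $q^2+q+1$ lines; every line contains $q+1$ points, every point lies on $q+1$ lines, any two lines meet in exactly one point and any two points lie on exactly one line. $r$-neighbor line percolation: for a set $A$ of points let $A^0=A$ and for $s\ge1$ let $A^s=A^{s-1}\cup\{P: \exists \text{ line } l\ni P \text{ with } |l\cap A^{s-1}|\ge r\}$; $A$ percolates if $A^k$ equals the whole point set for some $k$. $m_r(\Pi_q)$ is the minimum size of a percolating set. -}

module Defs where

open import Data.Nat using (ℕ; suc; _+_; _*_; _≤ᵇ_)
open import Data.Bool using (if_then_else_)
open import Data.Fin using (Fin)
open import Data.Fin.Subset using (Subset; ⊥; _∩_; _∪_; ⋃; ∣_∣)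
open import Data.List using (map)
open import Data.List using () renaming (allFin to allFinL)
open import Data.Vec using (tabulate; lookup)
open import Relation.Binary.PropositionalEquality using (_≡_; _≢_)

size : ℕ → ℕ
size q = q * q + q + 1

record ProjectivePlane (q : ℕ) : Set where
  field
    line : Fin (size q) → Subset (size q)
  linesThrough : Fin (size q) → Subset (size q)
  linesThrough P = tabulate (λ l → lookup (line l) P)
  field
    line-size       : ∀ l → ∣ line l ∣ ≡ q + 1
    point-degree    : ∀ P → ∣ linesThrough P ∣ ≡ q + 1
    lines-meet      : ∀ l m → l ≢ m → ∣ line l ∩ line m ∣ ≡ 1
    points-joined   : ∀ P Q → P ≢ Q → ∣ linesThrough P ∩ linesThrough Q ∣ ≡ 1

module _ {q : ℕ} (Π : ProjectivePlane q) (r : ℕ) where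
  open ProjectivePlane Π

  -- one round of r-neighbour line percolation:
  -- A^s = A^{s-1} ∪ ⋃ { l : |l ∩ A^{s-1}| ≥ r }
  step : Subset (size q) → Subset (size q)
  step A = A ∪ ⋃ (map (λ l → if r ≤ᵇ ∣ line l ∩ A ∣ then line l else ⊥) (allFinL (size q)))

  closure : ℕ → Subset (size q) → Subset (size q)
  closure 0 A = A
  closure (suc s) A = step (closure s A)

open import Data.Product using (∃)
open import Data.Fin.Subset using (⊤)

Percolates : {q : ℕ} → ProjectivePlane q → ℕ → Subset (size q) → Set
Percolates Π r A = ∃ λ k → closure Π r k A ≡ ⊤

-- Fix a point P, r lines through P, and r − 1 further points on each of them; together with P
-- these (r − 1) r + 1 points put r points on each chosen line, so after one round the r lines
-- are infected.  Every other point Q lies on a line m missing P, and m meets the r infected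
-- lines in r distinct points (two of them sharing a point of m would share two points), so
-- the second round infects Q.  If r > q + 1 the whole plane, of size q² + q + 1 ≤ (r − 1) r + 1,
-- percolates trivially.
module Submission where

open import Defs
open import Data.Nat using (ℕ; _≤_; _*_; _+_; _∸_)
open import Data.Fin.Subset using (Subset; ∣_∣)
open import Data.Product using (Σ; _×_)

open import Data.Nat using (zero; suc; z≤n; s≤s; _≤?_)
open import Data.Nat.Properties
  using (≤-trans; ≤-reflexive; +-suc; +-comm; *-comm; *-suc; +-monoʳ-≤; +-monoˡ-≤; *-mono-≤;
         +-cancelʳ-≤; m≤n+m; m≤n+o⇒m∸n≤o; m+n≤o⇒m≤o∸n; <⇒≤; m+[n∸m]≡n; ≤⇒≤ᵇ; ≰⇒>; module ≤-Reasoning)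
open import Data.Bool using (true; T; if_then_else_)
open import Data.Fin using (Fin; zero; suc; _≟_; fromℕ<)
open import Data.Fin.Properties using (0≢1+n; suc-injective)
open import Data.Fin.Subset
  using (⊥; ⊤; ⁅_⁆; _∈_; _∉_; _⊆_; _∪_; _∩_; _-_; ⋃; inside; outside)
open import Data.Fin.Subset.Properties
  using (_∈?_; x∈p∪q⁺; x∈p∩q⁺; x∈p∩q⁻; x∈⁅x⁆; x∈p∧x≢y⇒x∈p-y; x∈p⇒∣p-x∣<∣p∣; p─q⊆p;
         p⊆q⇒∣p∣≤∣q∣; ∣p∣≤∣x∷p∣; ∣⁅x⁆∣≡1; ∣⊥∣≡0; ∣⊤∣≡n; ∩-idem; ⊆-antisym; ⊆⊤)
open import Data.List using (List)
open import Data.List.Relation.Unary.Any as Any using (Any)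
import Data.List.Relation.Unary.Any.Properties as Anyₚ
open import Data.List.Membership.Propositional using (lose)
open import Data.List.Membership.Propositional.Properties using (∈-allFin)
open import Data.Vec using (Vec; []; _∷_; here; there; map; concat; lookup)
open import Data.Vec.Properties using ([]=⇒lookup; lookup⇒[]=; lookup∘tabulate)
open import Data.Vec.Relation.Unary.All as All using (All; []; _∷_)
import Data.Vec.Relation.Unary.All.Properties as Allₚ
open import Data.Vec.Relation.Unary.AllPairs using ([]; _∷_)
open import Data.Vec.Relation.Unary.Unique.Propositional using (Unique)
import Data.Vec.Relation.Unary.Unique.Propositional.Properties as Uniqueₚ
open import Data.Product using (_,_; ∃; proj₁; proj₂)
open import Data.Sum using (inj₁; inj₂)
open import Function using (_∘_)
open import Relation.Binary.PropositionalEquality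
  using (_≡_; _≢_; refl; sym; trans; cong; subst)
open import Relation.Nullary using (yes; no; contradiction)

private variable
  A B : Set
  k n : ℕ
  S : A → Set

Unique-map⁺-on : {f : A → B} {xs : Vec A k} →
                 (∀ {x y} → S x → S y → f x ≡ f y → x ≡ y) →
                 All S xs → Unique xs → Unique (map f xs)
Unique-map⁺-on inj [] [] = []
Unique-map⁺-on inj (px ∷ pxs) (x∉xs ∷ xs!) =
  Allₚ.map⁺ (All.map (λ (x≢y , py) → x≢y ∘ inj px py) (All.zip (x∉xs , pxs)))
  ∷ Unique-map⁺-on inj pxs xs!

record Selection (k : ℕ) (p : Subset n) : Set where
  field
    elements : Vec (Fin n) k
    unique   : Unique elements
    ⊆p       : All (_∈ p) elements

selection-∷ : ∀ {s} {p : Subset n} → Selection k p → Selection k (s ∷ p)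
selection-∷ σ = record
  { elements = map suc elements
  ; unique   = Uniqueₚ.map⁺ suc-injective unique
  ; ⊆p       = Allₚ.map⁺ (All.map there ⊆p)
  }
  where open Selection σ

selection-inside : {p : Subset n} → Selection k p → Selection (suc k) (inside ∷ p)
selection-inside σ = record
  { elements = zero ∷ elements
  ; unique   = Allₚ.map⁺ (All.universal (λ _ → 0≢1+n) _) ∷ unique
  ; ⊆p       = here ∷ ⊆p
  }
  where open Selection (selection-∷ {s = inside} σ)

select : ∀ k (p : Subset n) → k ≤ ∣ p ∣ → Selection k p
select zero    p             _          = record { elements = [] ; unique = [] ; ⊆p = [] }
select (suc k) (inside ∷ p)  (s≤s k≤∣p∣) = selection-inside (select k p k≤∣p∣)
select (suc k) (outside ∷ p) k<∣p∣      = selection-∷ (select (suc k) p k<∣p∣)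

unique∧⊆p⇒k≤∣p∣ : {p : Subset n} {xs : Vec (Fin n) k} → Unique xs → All (_∈ p) xs → k ≤ ∣ p ∣
unique∧⊆p⇒k≤∣p∣ [] [] = z≤n
unique∧⊆p⇒k≤∣p∣ (x∉xs ∷ xs!) (x∈p ∷ xs⊆p) =
  ≤-trans (s≤s (unique∧⊆p⇒k≤∣p∣ xs! xs⊆p-x)) (x∈p⇒∣p-x∣<∣p∣ x∈p)
  where
  xs⊆p-x = All.map (λ (x≢y , y∈p) → x∈p∧x≢y⇒x∈p-y y∈p (x≢y ∘ sym)) (All.zip (x∉xs , xs⊆p))

∣p∣≡1⇒x≡y : {p : Subset n} {x y : Fin n} → ∣ p ∣ ≡ 1 → x ∈ p → y ∈ p → x ≡ y
∣p∣≡1⇒x≡y {x = x} {y} ∣p∣≡1 x∈p y∈p with x ≟ y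
... | yes x≡y = x≡y
... | no  x≢y with subst (2 ≤_) ∣p∣≡1 (unique∧⊆p⇒k≤∣p∣ ((x≢y ∷ []) ∷ [] ∷ []) (x∈p ∷ y∈p ∷ []))
...   | s≤s ()

∣p∪q∣≤∣p∣+∣q∣ : (p q : Subset n) → ∣ p ∪ q ∣ ≤ ∣ p ∣ + ∣ q ∣
∣p∪q∣≤∣p∣+∣q∣ [] [] = z≤n
∣p∪q∣≤∣p∣+∣q∣ (inside ∷ p) (s ∷ q) =
  s≤s (≤-trans (∣p∪q∣≤∣p∣+∣q∣ p q) (+-monoʳ-≤ ∣ p ∣ (∣p∣≤∣x∷p∣ s q)))
∣p∪q∣≤∣p∣+∣q∣ (outside ∷ p) (inside ∷ q) =
  ≤-trans (s≤s (∣p∪q∣≤∣p∣+∣q∣ p q)) (≤-reflexive (sym (+-suc ∣ p ∣ ∣ q ∣)))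
∣p∪q∣≤∣p∣+∣q∣ (outside ∷ p) (outside ∷ q) = ∣p∪q∣≤∣p∣+∣q∣ p q

∣p∣≤∣p-x∣+1 : (p : Subset n) (x : Fin n) → ∣ p ∣ ≤ ∣ p - x ∣ + 1
∣p∣≤∣p-x∣+1 p x = begin
  ∣ p ∣                   ≤⟨ p⊆q⇒∣p∣≤∣q∣ p⊆p-x∪⁅x⁆ ⟩
  ∣ (p - x) ∪ ⁅ x ⁆ ∣     ≤⟨ ∣p∪q∣≤∣p∣+∣q∣ (p - x) ⁅ x ⁆ ⟩
  ∣ p - x ∣ + ∣ ⁅ x ⁆ ∣   ≡⟨ cong (∣ p - x ∣ +_) (∣⁅x⁆∣≡1 x) ⟩
  ∣ p - x ∣ + 1           ∎
  where
  open ≤-Reasoning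
  p⊆p-x∪⁅x⁆ : p ⊆ (p - x) ∪ ⁅ x ⁆
  p⊆p-x∪⁅x⁆ {y} y∈p with y ≟ x
  ... | yes refl = x∈p∪q⁺ (inj₂ (x∈⁅x⁆ x))
  ... | no  y≢x  = x∈p∪q⁺ (inj₁ (x∈p∧x≢y⇒x∈p-y y∈p y≢x))

x∉p-x : (p : Subset n) (x : Fin n) → x ∉ p - x
x∉p-x (inside  ∷ p) zero    ()
x∉p-x (outside ∷ p) zero    ()
x∉p-x (s ∷ p)       (suc x) (there x∈p-x) = x∉p-x p x x∈p-x

x∈p-y⇒x≢y : {p : Subset n} {x y : Fin n} → x ∈ p - y → x ≢ y
x∈p-y⇒x≢y {p = p} x∈p-x refl = x∉p-x p _ x∈p-x

fromVec : Vec (Fin n) k → Subset n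
fromVec []       = ⊥
fromVec (x ∷ xs) = ⁅ x ⁆ ∪ fromVec xs

∣fromVec∣≤k : (xs : Vec (Fin n) k) → ∣ fromVec xs ∣ ≤ k
∣fromVec∣≤k {n} [] = ≤-reflexive (∣⊥∣≡0 n)
∣fromVec∣≤k (x ∷ xs) =
  ≤-trans (∣p∪q∣≤∣p∣+∣q∣ ⁅ x ⁆ (fromVec xs))
          (subst (λ c → c + ∣ fromVec xs ∣ ≤ suc _) (sym (∣⁅x⁆∣≡1 x)) (s≤s (∣fromVec∣≤k xs)))

xs⊆fromVec : (xs : Vec (Fin n) k) → All (_∈ fromVec xs) xs
xs⊆fromVec []       = []
xs⊆fromVec (x ∷ xs) =
  x∈p∪q⁺ (inj₁ (x∈⁅x⁆ x)) ∷ All.map (λ y∈ → x∈p∪q⁺ (inj₂ y∈)) (xs⊆fromVec xs)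

x∈⋃⁺ : {ps : List (Subset n)} {x : Fin n} → Any (x ∈_) ps → x ∈ ⋃ ps
x∈⋃⁺ (Any.here  x∈p)  = x∈p∪q⁺ (inj₁ x∈p)
x∈⋃⁺ (Any.there x∈ps) = x∈p∪q⁺ (inj₂ (x∈⋃⁺ x∈ps))

module Incidence {q : ℕ} (Π : ProjectivePlane q) where
  open ProjectivePlane Π

  private variable
    l m : Fin (size q)
    X Y : Fin (size q)

  ∈-linesThrough⁺ : X ∈ line l → l ∈ linesThrough X
  ∈-linesThrough⁺ {X} {l} X∈l =
    lookup⇒[]= l _ (trans (lookup∘tabulate _ l) ([]=⇒lookup X∈l))

  ∈-linesThrough⁻ : l ∈ linesThrough X → X ∈ line l
  ∈-linesThrough⁻ {l} {X} l∈ =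
    lookup⇒[]= X _ (trans (sym (lookup∘tabulate (λ l → lookup (line l) X) l)) ([]=⇒lookup l∈))

  join-unique : X ≢ Y → X ∈ line l → Y ∈ line l → X ∈ line m → Y ∈ line m → l ≡ m
  join-unique X≢Y X∈l Y∈l X∈m Y∈m =
    ∣p∣≡1⇒x≡y (points-joined _ _ X≢Y)
      (x∈p∩q⁺ (∈-linesThrough⁺ X∈l , ∈-linesThrough⁺ Y∈l))
      (x∈p∩q⁺ (∈-linesThrough⁺ X∈m , ∈-linesThrough⁺ Y∈m))

  1≤∣line∩line∣ : ∀ l m → 1 ≤ ∣ line l ∩ line m ∣
  1≤∣line∩line∣ l m with l ≟ m
  ... | yes refl = subst (1 ≤_) (sym (trans (cong ∣_∣ (∩-idem (line l))) (line-size l))) (m≤n+m 1 q)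
  ... | no  l≢m  = ≤-reflexive (sym (lines-meet l m l≢m))

  meet : Fin (size q) → Fin (size q) → Fin (size q)
  meet l m = lookup (Selection.elements (select 1 (line l ∩ line m) (1≤∣line∩line∣ l m))) zero

  meet-∈ : ∀ l m → meet l m ∈ line l ∩ line m
  meet-∈ l m = Allₚ.lookup⁺ (Selection.⊆p (select 1 (line l ∩ line m) (1≤∣line∩line∣ l m))) zero

  meet-∈ˡ : ∀ l m → meet l m ∈ line l
  meet-∈ˡ l m = proj₁ (x∈p∩q⁻ (line l) (line m) (meet-∈ l m))

  meet-∈ʳ : ∀ l m → meet l m ∈ line m
  meet-∈ʳ l m = proj₂ (x∈p∩q⁻ (line l) (line m) (meet-∈ l m))

  meet-injective : ∀ {l l′} → X ∉ line m → X ∈ line l → X ∈ line l′ → meet l m ≡ meet l′ m → l ≡ l′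
  meet-injective {X} {m} {l} {l′} X∉m X∈l X∈l′ l∩m≡l′∩m =
    join-unique X≢l∩m X∈l (meet-∈ˡ l m) X∈l′ (subst (_∈ line l′) (sym l∩m≡l′∩m) (meet-∈ˡ l′ m))
    where
    X≢l∩m : X ≢ meet l m
    X≢l∩m refl = X∉m (meet-∈ʳ l m)

  q≤∣line-X∣ : ∀ l X → q ≤ ∣ line l - X ∣
  q≤∣line-X∣ l X = +-cancelʳ-≤ 1 q _
    (subst (_≤ ∣ line l - X ∣ + 1) (line-size l) (∣p∣≤∣p-x∣+1 (line l) X))

  line-avoiding : 1 ≤ q → X ≢ Y → ∃ λ m → Y ∈ line m × X ∉ line m
  line-avoiding {X} {Y} 1≤q X≢Y
    with select 2 (linesThrough Y) (subst (2 ≤_) (sym (point-degree Y)) (+-monoˡ-≤ 1 1≤q))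
  ... | record { elements = m₁ ∷ m₂ ∷ [] ; unique = (m₁≢m₂ ∷ []) ∷ _ ; ⊆p = m₁∋Y ∷ m₂∋Y ∷ [] }
    with X ∈? line m₁ | X ∈? line m₂
  ... | no X∉m₁ | _       = m₁ , ∈-linesThrough⁻ m₁∋Y , X∉m₁
  ... | yes _   | no X∉m₂ = m₂ , ∈-linesThrough⁻ m₂∋Y , X∉m₂
  ... | yes X∈m₁ | yes X∈m₂ = contradiction
    (join-unique X≢Y X∈m₁ (∈-linesThrough⁻ m₁∋Y) X∈m₂ (∈-linesThrough⁻ m₂∋Y)) m₁≢m₂

module Spread {q : ℕ} (Π : ProjectivePlane q) (r : ℕ) where
  open ProjectivePlane Π

  ⊆-step : (B : Subset (size q)) → B ⊆ step Π r B
  ⊆-step B = x∈p∪q⁺ ∘ inj₁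

  line⊆step : ∀ {B l} → r ≤ ∣ line l ∩ B ∣ → line l ⊆ step Π r B
  line⊆step {B} {l} r≤ x∈l =
    x∈p∪q⁺ (inj₂ (x∈⋃⁺ (Anyₚ.map⁺ (lose (∈-allFin l) (if-T (≤⇒≤ᵇ r≤))))))
    where
    if-T : ∀ {b} → T b → _ ∈ (if b then line l else ⊥)
    if-T {true} _ = x∈l

module Construction {q : ℕ} (Π : ProjectivePlane q) {r : ℕ} (1≤r : 1 ≤ r) (r≤q+1 : r ≤ q + 1)
                    (P : Fin (size q)) where
  open ProjectivePlane Π
  open Incidence Π
  open Spread Π r

  pencil : Selection r (linesThrough P)
  pencil = select r (linesThrough P) (subst (r ≤_) (sym (point-degree P)) r≤q+1)

  chosenLines : Vec (Fin (size q)) r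
  chosenLines = Selection.elements pencil

  chosenLines∋P : All (λ l → P ∈ line l) chosenLines
  chosenLines∋P = All.map ∈-linesThrough⁻ (Selection.⊆p pencil)

  chosenPoints : (l : Fin (size q)) → Selection (r ∸ 1) (line l - P)
  chosenPoints l = select (r ∸ 1) (line l - P) (≤-trans r∸1≤q (q≤∣line-X∣ l P))
    where
    r∸1≤q : r ∸ 1 ≤ q
    r∸1≤q = m≤n+o⇒m∸n≤o r 1 (subst (r ≤_) (+-comm q 1) r≤q+1)

  seedPoints : Vec (Fin (size q)) (1 + r * (r ∸ 1))
  seedPoints = P ∷ concat (map (Selection.elements ∘ chosenPoints) chosenLines)

  seed : Subset (size q)
  seed = fromVec seedPoints

  seedPoints⊆seed : All (_∈ seed) seedPoints
  seedPoints⊆seed = xs⊆fromVec seedPoints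

  ∣seed∣≤ : ∣ seed ∣ ≤ (r ∸ 1) * r + 1
  ∣seed∣≤ = subst (∣ seed ∣ ≤_) (trans (+-comm 1 _) (cong (_+ 1) (*-comm r (r ∸ 1))))
                  (∣fromVec∣≤k seedPoints)

  chosenPoints⊆seed : All (λ l → All (_∈ seed) (Selection.elements (chosenPoints l))) chosenLines
  chosenPoints⊆seed = Allₚ.map⁻ (Allₚ.concat⁻ _ (All.tail seedPoints⊆seed))

  r≤∣line∩seed∣ : ∀ {l} → P ∈ line l → All (_∈ seed) (Selection.elements (chosenPoints l)) →
                  r ≤ ∣ line l ∩ seed ∣
  r≤∣line∩seed∣ {l} P∈l points⊆seed =
    subst (_≤ ∣ line l ∩ seed ∣) (m+[n∸m]≡n 1≤r)
      (unique∧⊆p⇒k≤∣p∣ (All.map (λ x∈l-P → x∈p-y⇒x≢y x∈l-P ∘ sym) ⊆p ∷ unique)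
                        (x∈p∩q⁺ (P∈l , All.head seedPoints⊆seed)
                         ∷ All.map (λ (x∈l-P , x∈seed) → x∈p∩q⁺ (p─q⊆p (line l) ⁅ P ⁆ x∈l-P , x∈seed))
                                   (All.zip (⊆p , points⊆seed))))
    where open Selection (chosenPoints l)

  chosenLines⊆step : All (λ l → line l ⊆ step Π r seed) chosenLines
  chosenLines⊆step = All.map (λ (P∈l , points⊆seed) {x} → line⊆step (r≤∣line∩seed∣ P∈l points⊆seed) {x})
                             (All.zip (chosenLines∋P , chosenPoints⊆seed))

  r≤∣line∩step-seed∣ : ∀ {m} → P ∉ line m → r ≤ ∣ line m ∩ step Π r seed ∣
  r≤∣line∩step-seed∣ {m} P∉m =
    unique∧⊆p⇒k≤∣p∣ (Unique-map⁺-on (meet-injective P∉m) chosenLines∋P (Selection.unique pencil))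
                     (Allₚ.map⁺ (All.map (λ l⊆step → x∈p∩q⁺ (meet-∈ʳ _ m , l⊆step (meet-∈ˡ _ m)))
                                          chosenLines⊆step))

  seed-percolates : 1 ≤ q → Percolates Π r seed
  seed-percolates 1≤q = 2 , ⊆-antisym ⊆⊤ (λ {Q} _ → infected Q)
    where
    infected : ∀ Q → Q ∈ step Π r (step Π r seed)
    infected Q with P ≟ Q
    ... | yes refl = ⊆-step _ (⊆-step seed (All.head seedPoints⊆seed))
    ... | no  P≢Q  with line-avoiding 1≤q P≢Q
    ...   | m , Q∈m , P∉m = line⊆step (r≤∣line∩step-seed∣ P∉m) Q∈m

size≤[r∸1]*r+1 : ∀ {q r} → q + 1 ≤ r → size q ≤ (r ∸ 1) * r + 1
size≤[r∸1]*r+1 {q} {r} q+1≤r = +-monoˡ-≤ 1 (begin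
  q * q + q    ≡⟨ +-comm (q * q) q ⟩
  q + q * q    ≡⟨ *-suc q q ⟨
  q * suc q    ≤⟨ *-mono-≤ (m+n≤o⇒m≤o∸n q q+1≤r) (subst (_≤ r) (+-comm q 1) q+1≤r) ⟩
  (r ∸ 1) * r  ∎)
  where open ≤-Reasoning

proposition5 : (q : ℕ) → 2 ≤ q → (Π : ProjectivePlane q) → (r : ℕ) → 1 ≤ r →
    Σ (Subset (size q)) (λ A → (∣ A ∣ ≤ (r ∸ 1) * r + 1) × Percolates Π r A)
proposition5 q 2≤q Π r 1≤r with r ≤? q + 1
... | yes r≤q+1 = seed , ∣seed∣≤ , seed-percolates (≤-trans (s≤s z≤n) 2≤q)
  where open Construction Π 1≤r r≤q+1 (fromℕ< (m≤n+m 1 (q * q + q)))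
... | no  r≰q+1 = ⊤ , subst (_≤ (r ∸ 1) * r + 1) (sym (∣⊤∣≡n (size q))) (size≤[r∸1]*r+1 q+1≤r) , 0 , refl
  where
  q+1≤r : q + 1 ≤ r
  q+1≤r = <⇒≤ (≰⇒> r≰q+1)
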